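{- Let $G$ be a connected graph and $\mathcal{P}$ a set of robust regular bounded profiles in $G$. Let $P,P',Q,Q'\in\mathcal{P}$ with $P,P'$ distinguishable and $Q,Q'$ distinguishable, and let $(A,B)\in\mathcal{A}_{P,P'}$ and $(C,D)\in\mathcal{A}_{Q,Q'}$ with $|(A,B)|=|(C,D)|$. Then either there is a pair of opposite corner separations of $(A,B)$ and $(C,D)$ with one element in $\mathcal{A}_{P,P'}$ and one in $\mathcal{A}_{Q,Q'}$, or else there are two pairs of opposite corner separations of $(A,B)$ and $(C,D)$, the first with both elements in $\mathcal{A}_{P,P'}$ and the second with both elements in $\mathcal{A}_{Q,Q'}$.
   Context: A separation of $G=(V,E)$ is a pair $(A,B)$ with $A\cup B=V$ and no edge between $A\smallsetminus B$ and $B\smallsetminus A$; order $|(A,B)|=|A\cap B|$. $(A,B)\le(C,D)$ iff $A\subseteq C$ and $B\supseteq D$; join $(A,B)\lor(C,D)=(A\cup C,B\cap D)$. The corner separations of $(A,B),(C,D)$ are $(A,B)\lor(C,D)$, $(A,B)\lor(D,C)$, $(B,A)\lor(C,D)$, $(B,A)\lor(D,C)$ (and their inverses); for orientations $\vec r,\vec s$ of the two separations, $\vec r\lor\vec s$ and $\overleftarrow r\lor\overleftarrow s$ are called opposite corner separations. For $k\in\mathbb{N}\cup\{\aleph_0\}$, a $k$-profile is a set $P$ of separations of order $<k$ containing exactly one of $(A,B),(B,A)$ for each separation of order $<k$, consistent (no $(A,B),(C,D)\in P$ with $\{A,B\}\ne\{C,D\}$ and $(B,A)\le(C,D)$) and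 with $(B\cap D,A\cup C)\notin P$ for all $(A,B),(C,D)\in P$. Robust: for all $(A,B)\in P$ and every separation $(C,D)$ of finite order, if $|(A,B)\lor(C,D)|<|A\cap B|$ and $|(A,B)\lor(D,C)|<|A\cap B|$ then one of these joins lies in $P$. Regular: contains no $(V,X)$. Bounded: a $k$-profile for some $k\in\mathbb{N}$ not contained in any $\aleph_0$-profile. A separation distinguishes $P,P'$ if one orientation is in $P$ and the other in $P'$; efficiently if of minimal order among such; distinguishable if some separation distinguishes them. $\mathcal{A}_{P,P'}$ is the set of all oriented separations efficiently distinguishing $P,P'$. -}

module Defs where

open import Level using (0ℓ)
open import Data.Nat using (ℕ; _<_; _≤_)
open import Data.Bool using (Bool; true; false)
open import Data.Unit using (⊤)
open import Data.Empty using (⊥)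
open import Data.Product using (Σ; _×_; _,_; ∃; ∃-syntax; proj₁; proj₂)
open import Data.Sum using (_⊎_; inj₁; inj₂)
open import Data.List using (List; length)
open import Data.List.Membership.Propositional using (_∈_)
open import Data.List.Relation.Unary.Unique.Propositional using (Unique)
open import Relation.Nullary using (¬_)
open import Relation.Binary.PropositionalEquality using (_≡_)

record Graph : Set₁ where
  field
    V      : Set
    Adj    : V → V → Set
    sym    : ∀ {u v} → Adj u v → Adj v u
    irrefl : ∀ {v} → ¬ Adj v v

module _ (G : Graph) where
  open Graph G

  data Walk : V → V → Set where
    stay : ∀ {v} → Walk v v
    step : ∀ {u w v} → Adj u w → Walk w v → Walk u v

  Connected : Set
  Connected = ∀ u v → Walk u v

  Sub : Set₁
  Sub = V → Set

  Pair : Set₁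
  Pair = Sub × Sub

  full : Sub
  full _ = ⊤

  _∪_ : Sub → Sub → Sub
  (X ∪ Y) v = X v ⊎ Y v

  _∩_ : Sub → Sub → Sub
  (X ∩ Y) v = X v × Y v

  _⊆_ : Sub → Sub → Set
  X ⊆ Y = ∀ v → X v → Y v

  _≐ˢ_ : Sub → Sub → Set
  X ≐ˢ Y = X ⊆ Y × Y ⊆ X

  IsSep : Pair → Set
  IsSep (A , B) =
    (∀ v → A v ⊎ B v) ×
    (∀ u v → A u → ¬ B u → B v → ¬ A v → ¬ Adj u v)

  inv : Pair → Pair
  inv (A , B) = (B , A)

  _∨_ : Pair → Pair → Pair
  (A , B) ∨ (C , D) = (A ∪ C , B ∩ D)

  _≤ₛ_ : Pair → Pair → Set
  (A , B) ≤ₛ (C , D) = A ⊆ C × D ⊆ B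

  _≐_ : Pair → Pair → Set
  (A , B) ≐ (C , D) = A ≐ˢ C × B ≐ˢ D

  SameUnordered : Pair → Pair → Set
  SameUnordered (A , B) (C , D) = (A ≐ˢ C × B ≐ˢ D) ⊎ (A ≐ˢ D × B ≐ˢ C)

  orient : Bool → Pair → Pair
  orient true  s = s
  orient false s = inv s

  Card : Sub → ℕ → Set
  Card X n = Σ (List V) λ xs → length xs ≡ n × Unique xs × (∀ v → (X v → v ∈ xs) × (v ∈ xs → X v))

  HasOrder : Pair → ℕ → Set
  HasOrder (A , B) n = Card (A ∩ B) n

  data Bound : Set where
    fin    : ℕ → Bound
    aleph0 : Bound

  OrderLt : Pair → Bound → Set
  OrderLt s (fin k) = Σ ℕ λ n → HasOrder s n × n < k
  OrderLt s aleph0  = Σ ℕ λ n → HasOrder s n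

  SepSet : Set₁
  SepSet = Pair → Set

  record IsProfile (k : Bound) (P : SepSet) : Set₁ where
    field
      onlySeps    : ∀ s → P s → IsSep s × OrderLt s k
      extensional : ∀ s t → s ≐ t → P s → P t
      total       : ∀ s → IsSep s → OrderLt s k → P s ⊎ P (inv s)
      exactlyOne  : ∀ s → P s → P (inv s) → s ≐ inv s
      consistent  : ∀ A B C D → P (A , B) → P (C , D) →
                    ¬ SameUnordered (A , B) (C , D) → ¬ ((B , A) ≤ₛ (C , D))
      profileProp : ∀ r s → P r → P s → ¬ P (inv (r ∨ s))

  Robust : SepSet → Set₁
  Robust P = ∀ r s → P r → IsSep s → OrderLt s aleph0 → (n m l : ℕ) →
    HasOrder r n → HasOrder (r ∨ s) m → HasOrder (r ∨ inv s) l →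
    m < n → l < n → P (r ∨ s) ⊎ P (r ∨ inv s)

  Regular : SepSet → Set₁
  Regular P = ∀ (X : Sub) → ¬ P (full , X)

  Bounded : SepSet → Set₁
  Bounded P = Σ ℕ λ k → IsProfile (fin k) P ×
    ¬ (Σ SepSet λ Q → IsProfile aleph0 Q × (∀ s → P s → Q s))

  Distinguishes : SepSet → SepSet → Pair → Set
  Distinguishes P P' s = IsSep s × ((P s × P' (inv s)) ⊎ (P (inv s) × P' s))

  Distinguishable : SepSet → SepSet → Set₁
  Distinguishable P P' = Σ Pair λ s → Distinguishes P P' s

  𝒜 : SepSet → SepSet → Pair → Set₁
  𝒜 P P' s = Distinguishes P P' s × Σ ℕ λ n → HasOrder s n ×
    (∀ t m → Distinguishes P P' t → HasOrder t m → n ≤ m)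

-- Let k be the common order of r = (A , B) and s = (C , D). The profile among P, P′ that
-- contains a given orientation of r also orients s, say as s′; the corner of these two
-- orientations lies above r and is not inverted by that profile, so by consistency of the other
-- profile it distinguishes P and P′ as soon as its order is at most k, and then efficiency of r
-- forces its order to be exactly k.
-- Hence every row of the 2 × 2 table of corners contains a corner of order at least k that is
-- efficient for P, P′ once its order is k, and likewise every column for Q, Q′. By
-- submodularity two opposite corners have orders summing to at most 2k, so two such corners in
-- opposite position both have order k and are efficient. A pigeonhole argument on the table
-- finishes the proof.

module Submission where

open import Defs
open import Level using (Level)
open import Axiom.ExcludedMiddle using (ExcludedMiddle)
open import Algebra.Properties.CommutativeSemigroup using (interchange)
open import Data.Bool using (Bool; true; false; not)
open import Data.Empty using (⊥; ⊥-elim)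
open import Data.List using (List; []; _∷_; length; _++_; filter; deduplicate)
open import Data.List.Properties using (length-++-sucʳ)
open import Data.List.Membership.Propositional using (_∈_)
open import Data.List.Membership.Propositional.Properties
  using (∈-++⁺ˡ; ∈-++⁺ʳ; ∈-++⁻; ∈-∃++; ∈-filter⁺; ∈-filter⁻; ∈-deduplicate⁺)
open import Data.List.Relation.Unary.All using (lookup)
open import Data.List.Relation.Unary.AllPairs using (_∷_)
open import Data.List.Relation.Unary.Any using (here; there)
open import Data.List.Relation.Unary.Unique.Propositional using (Unique)
open import Data.List.Relation.Unary.Unique.Propositional.Properties using (filter⁺)
open import Data.List.Relation.Unary.Unique.DecPropositional.Properties using (deduplicate-!)
open import Data.Nat using (ℕ; suc; _+_; _≤_; _<_; z≤n; s≤s)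
open import Data.Nat.Properties
  using (≤-refl; ≤-trans; ≤-total; ≤-<-trans; ≤-antisym; +-mono-≤; +-monoʳ-≤; +-cancelʳ-≤;
         +-comm; +-commutativeSemigroup; module ≤-Reasoning)
open import Data.Product using (Σ; _×_; _,_; proj₁; proj₂; swap; map₂)
import Data.Product as Product
open import Data.Sum using (_⊎_; inj₁; inj₂; [_,_])
import Data.Sum as Sum
open import Data.Unit using (tt)
open import Function using (id; flip; _∘_)
open import Relation.Nullary using (¬_; Dec; yes; no)
open import Relation.Unary using (Decidable)
open import Relation.Binary.PropositionalEquality using (_≡_; refl; sym; trans; subst; subst₂; cong₂)

OppositePair : ∀ {ℓ} → (R S : Bool → Bool → Set ℓ) → Set ℓ
OppositePair R S = Σ Bool λ b → Σ Bool λ c → R b c × S (not b) (not c)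

module _ {ℓ} {R : Bool → Bool → Set ℓ} where

  opposite-or-constant : (∀ b → Σ Bool (R b)) →
                         OppositePair R R ⊎ Σ Bool (λ c → R true c × R false c)
  opposite-or-constant row with row true | row false
  ... | true  , r | true  , r′ = inj₂ (true , r , r′)
  ... | false , r | false , r′ = inj₂ (false , r , r′)
  ... | true  , r | false , r′ = inj₁ (true , true , r , r′)
  ... | false , r | true  , r′ = inj₁ (true , false , r , r′)

module _ {ℓ} {R S : Bool → Bool → Set ℓ} where

  private
    constant-row : ∀ {c} → R true c → R false c → Σ Bool (λ b → S b (not c)) → OppositePair R S
    constant-row {c} r r′ (true  , s) = false , c , r′ , s
    constant-row {c} r r′ (false , s) = true  , c , r  , s

    constant-column : ∀ {b} → S b true → S b false → Σ Bool (R (not b)) → OppositePair R S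
    constant-column {true}  s s′ (true  , r) = false , true  , r , s′
    constant-column {true}  s s′ (false , r) = false , false , r , s
    constant-column {false} s s′ (true  , r) = true  , true  , r , s′
    constant-column {false} s s′ (false , r) = true  , false , r , s

  opposite-cells : (∀ b → Σ Bool (R b)) → (∀ c → Σ Bool λ b → S b c) →
                   OppositePair R S ⊎ (OppositePair R R × OppositePair S S)
  opposite-cells rows columns
    with opposite-or-constant rows | opposite-or-constant {R = flip S} columns
  ... | inj₁ R-pair            | inj₁ (c , b , s , s′) = inj₂ (R-pair , b , c , s , s′)
  ... | inj₂ (c , r , r′)      | _                     = inj₁ (constant-row r r′ (columns (not c)))
  ... | inj₁ _                 | inj₂ (b , s , s′)     = inj₁ (constant-column s s′ (rows (not b)))

indicator : ∀ {p} {P : Set p} → Dec P → ℕ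
indicator (yes _) = 1
indicator (no _)  = 0

indicator-⊎ : ∀ {p} {P Q : Set p} (d : Dec P) (e : Dec Q) → P ⊎ Q → 1 ≤ indicator d + indicator e
indicator-⊎ (yes _)  _        _         = s≤s z≤n
indicator-⊎ (no _)   (yes _)  _         = s≤s z≤n
indicator-⊎ (no ¬p)  (no _)   (inj₁ p)  = ⊥-elim (¬p p)
indicator-⊎ (no _)   (no ¬q)  (inj₂ q)  = ⊥-elim (¬q q)

indicator-submodular : ∀ {p} {P₁ P₂ P₃ P₄ : Set p} (d₁ : Dec P₁) (d₂ : Dec P₂) (d₃ : Dec P₃) (d₄ : Dec P₄) →
                       (P₁ × P₂ → P₃ × P₄) → (P₁ ⊎ P₂ → P₃ ⊎ P₄) →
                       indicator d₁ + indicator d₂ ≤ indicator d₃ + indicator d₄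
indicator-submodular (no _)   (no _)   _        _        _    _      = z≤n
indicator-submodular (yes _)  (yes _)  (yes _)  (yes _)  _    _      = ≤-refl
indicator-submodular (yes p₁) (yes p₂) (no ¬p₃) _        both _      = ⊥-elim (¬p₃ (proj₁ (both (p₁ , p₂))))
indicator-submodular (yes p₁) (yes p₂) _        (no ¬p₄) both _      = ⊥-elim (¬p₄ (proj₂ (both (p₁ , p₂))))
indicator-submodular (yes p₁) (no _)   d₃       d₄       _    either = indicator-⊎ d₃ d₄ (either (inj₁ p₁))
indicator-submodular (no _)   (yes p₂) d₃       d₄       _    either = indicator-⊎ d₃ d₄ (either (inj₂ p₂))

module _ {a} {A : Set a} where

  Unique-⊆⇒length≤ : ∀ {xs ys : List A} → Unique xs → (∀ {v} → v ∈ xs → v ∈ ys) →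
                     length xs ≤ length ys
  Unique-⊆⇒length≤ {[]}     _              _     = z≤n
  Unique-⊆⇒length≤ {x ∷ xs} (x∉xs ∷ !xs) xs⊆ys with ∈-∃++ (xs⊆ys (here refl))
  ... | ys₁ , ys₂ , refl =
    subst (suc (length xs) ≤_) (sym (length-++-sucʳ ys₁ x ys₂)) (s≤s (Unique-⊆⇒length≤ !xs xs⊆ys₁++ys₂))
    where
    xs⊆ys₁++ys₂ : ∀ {v} → v ∈ xs → v ∈ ys₁ ++ ys₂
    xs⊆ys₁++ys₂ v∈xs with ∈-++⁻ ys₁ (xs⊆ys (there v∈xs))
    ... | inj₁ v∈ys₁         = ∈-++⁺ˡ v∈ys₁
    ... | inj₂ (here refl)   = ⊥-elim (lookup x∉xs v∈xs refl)
    ... | inj₂ (there v∈ys₂) = ∈-++⁺ʳ ys₁ v∈ys₂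

module Separations (lem : ∀ {ℓ : Level} → ExcludedMiddle ℓ) (G : Graph) where
  open Graph G using (V; Adj)

  infixl 6 _⊔_
  infix 10 _⁻¹

  _⊔_ : Pair G → Pair G → Pair G
  _⊔_ = _∨_ G

  _⁻¹ : Pair G → Pair G
  _⁻¹ = inv G

  separator : Pair G → Sub G
  separator (A , B) = _∩_ G A B

  Card-unique : ∀ {Z m n} → Card G Z m → Card G Z n → m ≡ n
  Card-unique (xs , refl , !xs , xs≐Z) (ys , refl , !ys , ys≐Z) =
    ≤-antisym (Unique-⊆⇒length≤ !xs λ {v} v∈xs → proj₁ (ys≐Z v) (proj₂ (xs≐Z v) v∈xs))
              (Unique-⊆⇒length≤ !ys λ {v} v∈ys → proj₁ (xs≐Z v) (proj₂ (ys≐Z v) v∈ys))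

  Card-resp-≐ˢ : ∀ {Z W n} → _≐ˢ_ G Z W → Card G Z n → Card G W n
  Card-resp-≐ˢ (Z⊆W , W⊆Z) (xs , len , !xs , xs≐Z) =
    xs , len , !xs , λ v → (λ w → proj₁ (xs≐Z v) (W⊆Z v w)) , (λ v∈xs → Z⊆W v (proj₂ (xs≐Z v) v∈xs))

  private
    _≟_ : (u v : V) → Dec (u ≡ v)
    _ ≟ _ = lem

  decide : (Z : Sub G) → Decidable Z
  decide Z _ = lem

  count : Sub G → List V → ℕ
  count Z L = length (filter (decide Z) L)

  Card-count : ∀ {Z L} → Unique L → (∀ v → Z v → v ∈ L) → Card G Z (count Z L)
  Card-count {Z} {L} !L Z⊆L =
    filter (decide Z) L , refl , filter⁺ (decide Z) !L ,
    λ v → (λ z → ∈-filter⁺ (decide Z) (Z⊆L v z) z) , (λ v∈ → proj₂ (∈-filter⁻ (decide Z) {xs = L} v∈))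

  count-∷ : ∀ Z v vs → count Z (v ∷ vs) ≡ indicator (decide Z v) + count Z vs
  count-∷ Z v vs with decide Z v
  ... | yes _ = refl
  ... | no _  = refl

  count-submodular : ∀ {Z₁ Z₂ Z₃ Z₄} L → (∀ v → Z₁ v × Z₂ v → Z₃ v × Z₄ v) → (∀ v → Z₁ v ⊎ Z₂ v → Z₃ v ⊎ Z₄ v) →
                     count Z₁ L + count Z₂ L ≤ count Z₃ L + count Z₄ L
  count-submodular []       _    _      = z≤n
  count-submodular {Z₁} {Z₂} {Z₃} {Z₄} (v ∷ vs) both either = begin
    count Z₁ (v ∷ vs) + count Z₂ (v ∷ vs)
      ≡⟨ count-∷-+ Z₁ Z₂ ⟩
    (indicator (decide Z₁ v) + indicator (decide Z₂ v)) + (count Z₁ vs + count Z₂ vs)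
      ≤⟨ +-mono-≤ (indicator-submodular (decide Z₁ v) (decide Z₂ v) (decide Z₃ v) (decide Z₄ v) (both v) (either v))
                  (count-submodular vs both either) ⟩
    (indicator (decide Z₃ v) + indicator (decide Z₄ v)) + (count Z₃ vs + count Z₄ vs)
      ≡⟨ count-∷-+ Z₃ Z₄ ⟨
    count Z₃ (v ∷ vs) + count Z₄ (v ∷ vs) ∎
    where
    open ≤-Reasoning
    count-∷-+ : ∀ Z W → count Z (v ∷ vs) + count W (v ∷ vs) ≡
                        (indicator (decide Z v) + indicator (decide W v)) + (count Z vs + count W vs)
    count-∷-+ Z W = trans (cong₂ _+_ (count-∷ Z v vs) (count-∷ W v vs))
                          (interchange +-commutativeSemigroup (indicator (decide Z v)) (count Z vs)
                                                              (indicator (decide W v)) (count W vs))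

  order-submodular : ∀ r s {k₁ k₂} → HasOrder G r k₁ → HasOrder G s k₂ →
               Σ ℕ λ m₁ → Σ ℕ λ m₂ →
                 HasOrder G (r ⊔ s) m₁ × HasOrder G (r ⁻¹ ⊔ s ⁻¹) m₂ × m₁ + m₂ ≤ k₁ + k₂
  order-submodular r@(A , B) s@(C , D) r-order@(xs , _ , _ , xs≐r) s-order@(ys , _ , _ , ys≐s) =
    _ , _ , Card-count !L (λ v z → covers v (corners⊆ v (inj₁ z))) ,
            Card-count !L (λ v z → covers v (corners⊆ v (inj₂ z))) ,
    subst₂ (λ k₁ k₂ → count (separator (r ⊔ s)) L + count (separator (r ⁻¹ ⊔ s ⁻¹)) L ≤ k₁ + k₂)
      (Card-unique (Card-count !L (λ v z → covers v (inj₁ z))) r-order)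
      (Card-unique (Card-count !L (λ v z → covers v (inj₂ z))) s-order)
      (count-submodular L corners-meet corners⊆)
    where
    L : List V
    L = deduplicate _≟_ (xs ++ ys)
    !L : Unique L
    !L = deduplicate-! _≟_ (xs ++ ys)
    covers : ∀ v → separator r v ⊎ separator s v → v ∈ L
    covers v = [ (λ z → ∈-deduplicate⁺ _≟_ (∈-++⁺ˡ (proj₁ (xs≐r v) z))) ,
                 (λ z → ∈-deduplicate⁺ _≟_ (∈-++⁺ʳ xs (proj₁ (ys≐s v) z))) ]
    corners-meet : ∀ v → separator (r ⊔ s) v × separator (r ⁻¹ ⊔ s ⁻¹) v → separator r v × separator s v
    corners-meet v ((_ , b , d) , (_ , a , c)) = (a , b) , (c , d)
    corners⊆ : ∀ v → separator (r ⊔ s) v ⊎ separator (r ⁻¹ ⊔ s ⁻¹) v → separator r v ⊎ separator s v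
    corners⊆ v (inj₁ (inj₁ a , b , _)) = inj₁ (a , b)
    corners⊆ v (inj₁ (inj₂ c , _ , d)) = inj₂ (c , d)
    corners⊆ v (inj₂ (inj₁ b , a , _)) = inj₁ (a , b)
    corners⊆ v (inj₂ (inj₂ d , _ , c)) = inj₂ (c , d)

  HasOrder-inv : ∀ {r n} → HasOrder G r n → HasOrder G (r ⁻¹) n
  HasOrder-inv = Card-resp-≐ˢ ((λ _ → swap) , (λ _ → swap))

  HasOrder-orient : ∀ b {r n} → HasOrder G r n → HasOrder G (orient G b r) n
  HasOrder-orient true  = id
  HasOrder-orient false = HasOrder-inv

  orient-not : ∀ b r → orient G (not b) r ≡ orient G b r ⁻¹
  orient-not true  r = refl
  orient-not false r = refl

  x≤x⊔y : ∀ x y → _≤ₛ_ G x (x ⊔ y)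
  x≤x⊔y x y = (λ _ → inj₁) , (λ _ → proj₁)

  y≤x⊔y : ∀ x y → _≤ₛ_ G y (x ⊔ y)
  y≤x⊔y x y = (λ _ → inj₂) , (λ _ → proj₂)

  IsSep-inv : ∀ {r} → IsSep G r → IsSep G (r ⁻¹)
  IsSep-inv (cover , no-edge) =
    (λ v → Sum.swap (cover v)) ,
    (λ u v b ¬a a ¬b adj → no-edge v u a ¬b b ¬a (Graph.sym G adj))

  IsSep-orient : ∀ b {r} → IsSep G r → IsSep G (orient G b r)
  IsSep-orient true  = id
  IsSep-orient false = IsSep-inv

  IsSep-⊔ : ∀ {r s} → IsSep G r → IsSep G s → IsSep G (r ⊔ s)
  IsSep-⊔ {A , B} {C , D} (coverʳ , no-edgeʳ) (coverˢ , no-edgeˢ) = cover , no-edge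
    where
    cover : ∀ v → (A v ⊎ C v) ⊎ (B v × D v)
    cover v with coverʳ v | coverˢ v
    ... | inj₁ a | _      = inj₁ (inj₁ a)
    ... | inj₂ _ | inj₁ c = inj₁ (inj₂ c)
    ... | inj₂ b | inj₂ d = inj₂ (b , d)
    -- an endpoint outside B ∩ D lies in A ∖ B or in C ∖ D
    no-edge : ∀ u v → A u ⊎ C u → ¬ (B u × D u) → B v × D v → ¬ (A v ⊎ C v) → ¬ Adj u v
    no-edge u v (inj₁ a) ¬bd (b′ , d′) ¬ac with decide B u | coverˢ u
    ... | no ¬b | _      = no-edgeʳ u v a ¬b b′ (¬ac ∘ inj₁)
    ... | yes b | inj₁ c = no-edgeˢ u v c (λ d → ¬bd (b , d)) d′ (¬ac ∘ inj₂)
    ... | yes b | inj₂ d = ⊥-elim (¬bd (b , d))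
    no-edge u v (inj₂ c) ¬bd (b′ , d′) ¬ac with decide D u | coverʳ u
    ... | no ¬d | _      = no-edgeˢ u v c ¬d d′ (¬ac ∘ inj₂)
    ... | yes d | inj₁ a = no-edgeʳ u v a (λ b → ¬bd (b , d)) b′ (¬ac ∘ inj₁)
    ... | yes d | inj₂ b = ⊥-elim (¬bd (b , d))

  record RegularProfile (P : SepSet G) : Set₁ where
    field
      bound     : ℕ
      isProfile : IsProfile G (fin bound) P
      regular   : Regular G P
    open IsProfile isProfile public

  open RegularProfile

  not-both-orientations : ∀ {P r} → RegularProfile P → IsSep G r → P r → ¬ P (r ⁻¹)
  not-both-orientations {r = A , B} pP (cover , _) pr pr⁻¹ with exactlyOne pP (A , B) pr pr⁻¹
  ... | (A⊆B , B⊆A) , _ =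
    regular pP B (extensional pP (A , B) (full G , B)
      (((λ _ _ → tt) , (λ v _ → [ id , B⊆A v ] (cover v))) , ((λ _ b → b) , (λ _ b → b))) pr)

  order<bound : ∀ {P r k} (pP : RegularProfile P) → P r → HasOrder G r k → k < bound pP
  order<bound pP pr r-order with onlySeps pP _ pr
  ... | _ , n , n-order , n<bound = subst (_< bound pP) (Card-unique n-order r-order) n<bound

  orientation : ∀ {P s k} (pP : RegularProfile P) → IsSep G s → HasOrder G s k → k < bound pP →
                Σ Bool λ c → P (orient G c s)
  orientation {s = s} {k} pP ss s-order k<bound with total pP s ss (k , s-order , k<bound)
  ... | inj₁ ps   = true , ps
  ... | inj₂ ps⁻¹ = false , ps⁻¹

  Distinguishes-sym : ∀ {P P′ t} → Distinguishes G P P′ t → Distinguishes G P′ P t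
  Distinguishes-sym (st , d) = st , Sum.swap (Sum.map swap swap d)

  𝒜-sym : ∀ {P P′ t} → 𝒜 G P P′ t → 𝒜 G P′ P t
  𝒜-sym {P} {P′} (d , n , t-order , minimal) =
    Distinguishes-sym {P} {P′} d , n , t-order , λ t′ m d′ → minimal t′ m (Distinguishes-sym {P′} {P} d′)

  𝒜-orient : ∀ {P P′ t} b → 𝒜 G P P′ t → 𝒜 G P P′ (orient G b t)
  𝒜-orient true  = id
  𝒜-orient false ((st , d) , n , t-order , minimal) =
    (IsSep-inv st , Sum.swap d) , n , HasOrder-inv t-order , minimal

  𝒜-minimal : ∀ {P P′ x t k m} → 𝒜 G P P′ x → HasOrder G x k → Distinguishes G P P′ t → HasOrder G t m → k ≤ m
  𝒜-minimal (_ , n , n-order , minimal) x-order d t-order =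
    subst (_≤ _) (Card-unique n-order x-order) (minimal _ _ d t-order)

  record Tight (k : ℕ) (F : Pair G → Set₁) (t : Pair G) : Set₁ where
    field
      k≤order     : ∀ {m} → HasOrder G t m → k ≤ m
      if-order≤k : ∀ {m} → HasOrder G t m → m ≤ k → F t

  open Tight

  Tight-map : ∀ {k F F′ t} → (F t → F′ t) → Tight k F t → Tight k F′ t
  Tight-map f tight = record { k≤order = k≤order tight ; if-order≤k = λ o le → f (if-order≤k tight o le) }

  module _ {P P′} (pP : RegularProfile P) (pP′ : RegularProfile P′)
           {x k} (x∈𝒜 : 𝒜 G P P′ x) (x-order : HasOrder G x k) (px : P x) where

    private
      sx : IsSep G x
      sx = proj₁ (proj₁ x∈𝒜)

      p′x⁻¹ : P′ (x ⁻¹)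
      p′x⁻¹ with proj₂ (proj₁ x∈𝒜)
      ... | inj₁ (_ , p′x⁻¹) = p′x⁻¹
      ... | inj₂ (px⁻¹ , _)  = ⊥-elim (not-both-orientations pP sx px px⁻¹)

    distinguishes-above : ∀ {t m} → IsSep G t → _≤ₛ_ G x t → ¬ P (t ⁻¹) → HasOrder G t m → m ≤ k →
                          Distinguishes G P P′ t
    distinguishes-above {t} {m} st x≤t p∌t⁻¹ t-order m≤k = st , inj₁ (pt , p′t⁻¹)
      where
      pt : P t
      pt = [ id , ⊥-elim ∘ p∌t⁻¹ ]
             (total pP t st (m , t-order , ≤-<-trans m≤k (order<bound pP px x-order)))
      x⁻¹≁t : P′ t → ¬ SameUnordered G (x ⁻¹) t
      x⁻¹≁t _   (inj₁ (x₂≐t₁ , x₁≐t₂)) = p∌t⁻¹ (extensional pP x (t ⁻¹) (x₁≐t₂ , x₂≐t₁) px)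
      x⁻¹≁t p′t (inj₂ (x₂≐t₂ , x₁≐t₁)) =
        not-both-orientations pP′ sx (extensional pP′ t x (swap x₁≐t₁ , swap x₂≐t₂) p′t) p′x⁻¹
      p′t⁻¹ : P′ (t ⁻¹)
      p′t⁻¹ = [ (λ p′t → ⊥-elim (consistent pP′ _ _ _ _ p′x⁻¹ p′t (x⁻¹≁t p′t) x≤t)) , id ]
                (total pP′ t st (m , t-order , ≤-<-trans m≤k (order<bound pP′ p′x⁻¹ (HasOrder-inv x-order))))

    tight-above : ∀ {t} → IsSep G t → _≤ₛ_ G x t → ¬ P (t ⁻¹) → Tight k (𝒜 G P P′) t
    tight-above {t} st x≤t p∌t⁻¹ = record { k≤order = k≤order′ ; if-order≤k = efficient }
      where
      k≤order′ : ∀ {m} → HasOrder G t m → k ≤ m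
      k≤order′ {m} t-order with ≤-total k m
      ... | inj₁ k≤m = k≤m
      ... | inj₂ m≤k = 𝒜-minimal x∈𝒜 x-order (distinguishes-above st x≤t p∌t⁻¹ t-order m≤k) t-order
      efficient : ∀ {m} → HasOrder G t m → m ≤ k → 𝒜 G P P′ t
      efficient {m} t-order m≤k =
        distinguishes-above st x≤t p∌t⁻¹ t-order m≤k , m , t-order ,
        λ _ _ d o → ≤-trans m≤k (𝒜-minimal x∈𝒜 x-order d o)

    tight-joins-from : ∀ {y} → IsSep G y → HasOrder G y k →
                       Σ Bool λ c → Tight k (𝒜 G P P′) (x ⊔ orient G c y) × Tight k (𝒜 G P P′) (orient G c y ⊔ x)
    tight-joins-from {y} sy y-order with orientation pP sy y-order (order<bound pP px x-order)
    ... | c , py =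
      c , tight-above (IsSep-⊔ sx syᶜ) (x≤x⊔y x yᶜ) (profileProp pP x yᶜ px py)
        , tight-above (IsSep-⊔ syᶜ sx) (y≤x⊔y yᶜ x) (profileProp pP yᶜ x py px)
      where
      yᶜ : Pair G
      yᶜ = orient G c y
      syᶜ : IsSep G yᶜ
      syᶜ = IsSep-orient c sy

  tight-joins : ∀ {P P′ x y k} → RegularProfile P → RegularProfile P′ → 𝒜 G P P′ x → HasOrder G x k →
                IsSep G y → HasOrder G y k →
                Σ Bool λ c → Tight k (𝒜 G P P′) (x ⊔ orient G c y) × Tight k (𝒜 G P P′) (orient G c y ⊔ x)
  tight-joins pP pP′ x∈𝒜@((_ , inj₁ (px , _)) , _) x-order = tight-joins-from pP pP′ x∈𝒜 x-order px
  tight-joins {P} {P′} pP pP′ x∈𝒜@((_ , inj₂ (_ , p′x)) , _) x-order sy y-order =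
    map₂ (Product.map (Tight-map (𝒜-sym {P′} {P})) (Tight-map (𝒜-sym {P′} {P})))
         (tight-joins-from pP′ pP (𝒜-sym {P} {P′} x∈𝒜) x-order p′x sy y-order)

  opposite-tight : ∀ {k} {F₁ F₂ : Pair G → Set₁} r s → HasOrder G r k → HasOrder G s k →
                   Tight k F₁ (r ⊔ s) → Tight k F₂ (r ⁻¹ ⊔ s ⁻¹) → F₁ (r ⊔ s) × F₂ (r ⁻¹ ⊔ s ⁻¹)
  opposite-tight {k} r s r-order s-order tight₁ tight₂ with order-submodular r s r-order s-order
  ... | m₁ , m₂ , m₁-order , m₂-order , m₁+m₂≤2k =
    if-order≤k tight₁ m₁-order (≤k m₁+m₂≤2k (k≤order tight₂ m₂-order)) ,
    if-order≤k tight₂ m₂-order (≤k (subst (_≤ k + k) (+-comm m₁ m₂) m₁+m₂≤2k) (k≤order tight₁ m₁-order))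
    where
    ≤k : ∀ {m n} → m + n ≤ k + k → k ≤ n → m ≤ k
    ≤k {m} m+n≤2k k≤n = +-cancelʳ-≤ k m k (≤-trans (+-monoʳ-≤ m k≤n) m+n≤2k)

  corner : Pair G → Pair G → Bool → Bool → Pair G
  corner r s b c = orient G b r ⊔ orient G c s

  OppositeCorners : Pair G → Pair G → (F₁ F₂ : Pair G → Set₁) → Set₁
  OppositeCorners r s F₁ F₂ =
    Σ Bool λ b → Σ Bool λ c → F₁ (corner r s b c) × F₂ (orient G b r ⁻¹ ⊔ orient G c s ⁻¹)

  opposite-tight-corners : ∀ {k F₁ F₂ r s} → HasOrder G r k → HasOrder G s k →
                           OppositePair (λ b c → Tight k F₁ (corner r s b c)) (λ b c → Tight k F₂ (corner r s b c)) →
                           OppositeCorners r s F₁ F₂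
  opposite-tight-corners {k} {F₂ = F₂} {r} {s} r-order s-order (b , c , tight₁ , tight₂) =
    b , c , opposite-tight (orient G b r) (orient G c s) (HasOrder-orient b r-order) (HasOrder-orient c s-order)
                           tight₁ (subst (Tight k F₂) (cong₂ _⊔_ (orient-not b r) (orient-not c s)) tight₂)

lemma4p8 : (lem : ∀ {ℓ : Level} → ExcludedMiddle ℓ) →
    (G : Graph) → Connected G →
    (𝒫 : SepSet G → Set₁) →
    (∀ P → 𝒫 P → Robust G P × Regular G P × Bounded G P) →
    (P P′ Q Q′ : SepSet G) → 𝒫 P → 𝒫 P′ → 𝒫 Q → 𝒫 Q′ →
    Distinguishable G P P′ → Distinguishable G Q Q′ →
    (A B C D : Sub G) →
    𝒜 G P P′ (A , B) → 𝒜 G Q Q′ (C , D) →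
    (Σ ℕ λ n → HasOrder G (A , B) n × HasOrder G (C , D) n) →
    (Σ Bool λ b → Σ Bool λ c →
        𝒜 G P P′ (_∨_ G (orient G b (A , B)) (orient G c (C , D))) ×
        𝒜 G Q Q′ (_∨_ G (inv G (orient G b (A , B))) (inv G (orient G c (C , D)))))
    ⊎
    ((Σ Bool λ b → Σ Bool λ c →
        𝒜 G P P′ (_∨_ G (orient G b (A , B)) (orient G c (C , D))) ×
        𝒜 G P P′ (_∨_ G (inv G (orient G b (A , B))) (inv G (orient G c (C , D)))))
     ×
     (Σ Bool λ b → Σ Bool λ c →
        𝒜 G Q Q′ (_∨_ G (orient G b (A , B)) (orient G c (C , D))) ×
        𝒜 G Q Q′ (_∨_ G (inv G (orient G b (A , B))) (inv G (orient G c (C , D))))))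
lemma4p8 lem G _ 𝒫 𝒫-properties P P′ Q Q′ 𝒫P 𝒫P′ 𝒫Q 𝒫Q′ _ _ A B C D r∈𝒜 s∈𝒜 (k , r-order , s-order) =
  Sum.map corners (Product.map corners corners) (opposite-cells rows columns)
  where
  open Separations lem G
  r s : Pair G
  r = A , B
  s = C , D
  regularProfile : ∀ {Z} → 𝒫 Z → RegularProfile Z
  regularProfile 𝒫Z with _ , regular , bound , isProfile , _ ← 𝒫-properties _ 𝒫Z =
    record { bound = bound ; isProfile = isProfile ; regular = regular }
  rows : ∀ b → Σ Bool λ c → Tight k (𝒜 G P P′) (corner r s b c)
  rows b = map₂ proj₁ (tight-joins (regularProfile 𝒫P) (regularProfile 𝒫P′) (𝒜-orient b r∈𝒜)
                                   (HasOrder-orient b r-order) (proj₁ (proj₁ s∈𝒜)) s-order)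
  columns : ∀ c → Σ Bool λ b → Tight k (𝒜 G Q Q′) (corner r s b c)
  columns c = map₂ proj₂ (tight-joins (regularProfile 𝒫Q) (regularProfile 𝒫Q′) (𝒜-orient c s∈𝒜)
                                      (HasOrder-orient c s-order) (proj₁ (proj₁ r∈𝒜)) r-order)
  corners : ∀ {F₁ F₂} → OppositePair (λ b c → Tight k F₁ (corner r s b c)) (λ b c → Tight k F₂ (corner r s b c)) →
            OppositeCorners r s F₁ F₂
  corners = opposite-tight-corners r-order s-order
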